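{- Let $(P^T_n)_{n\ge 0}$ be the sequence of polynomials in one variable $m$ defined by $P^T_0(m)=0$, $P^T_1(m)=m$ and, for $n\ge 1$, $P^T_{n+1}(m)=P^T_n(m+1)+\sum_{k=1}^{n-1}P^T_k(m)\,P^T_{n-k}(m)$. Then for every integer $p\ge 1$, $\deg P^T_{2p-1}=\deg P^T_{2p}=p$.
   Context: For each $n$, $P^T_n(m)$ equals the number $T_{n,m}$ of untyped lambda terms of size $n$ written with de Bruijn indices in $\{1,\dots,m\}$ (a de Bruijn index has size 1, and abstraction and application each add 1 to the size); the recurrence above is the defining recurrence. -}

module Defs where

open import Data.Nat using (ℕ; zero; suc; _+_; _*_; _<_)
open import Data.List using (List; []; _∷_; map; zipWith; reverse; foldr)
open import Data.Product using (_×_)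
open import Relation.Binary.PropositionalEquality using (_≡_; _≢_)

-- Univariate polynomials in m, as coefficient lists (constant term first).
-- Trailing zeros are allowed; the empty list is the zero polynomial.
-- All P^T_n have coefficients in ℕ (the recurrence only adds, multiplies
-- and shifts), so ℕ-coefficients suffice; the operations below are the
-- usual polynomial semiring operations.
Poly : Set
Poly = List ℕ

coeff : Poly → ℕ → ℕ
coeff []       _       = 0
coeff (a ∷ p)  zero    = a
coeff (a ∷ p)  (suc i) = coeff p i

infixl 6 _⊕_
infixl 7 _⊗_

_⊕_ : Poly → Poly → Poly
[]      ⊕ q       = q
(a ∷ p) ⊕ []      = a ∷ p
(a ∷ p) ⊕ (b ∷ q) = (a + b) ∷ (p ⊕ q)

_⊗_ : Poly → Poly → Poly
[]      ⊗ q = []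
(a ∷ p) ⊗ q = map (a *_) q ⊕ (0 ∷ (p ⊗ q))

-- shift p  is the polynomial  m ↦ p(m+1)
-- (a + m·p'(m))(m+1) = a + (1 + m)·p'(m+1)
shift : Poly → Poly
shift []      = []
shift (a ∷ p) = (a ∷ []) ⊕ ((1 ∷ 1 ∷ []) ⊗ shift p)

polySum : List Poly → Poly
polySum = foldr _⊕_ []

-- For rest = [P_n, …, P_1]:  conv rest = Σ_{k=1}^{n} P_k · P_{n+1-k}
conv : List Poly → Poly
conv rest = polySum (zipWith _⊗_ rest (reverse rest))

next : List Poly → List Poly
next []         = []
next (p ∷ rest) = (shift p ⊕ conv rest) ∷ p ∷ rest

-- revTable n = [P_n, P_{n-1}, …, P_1]
revTable : ℕ → List Poly
revTable zero          = []
revTable (suc zero)    = (0 ∷ 1 ∷ []) ∷ []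
revTable (suc (suc n)) = next (revTable (suc n))

PT : ℕ → Poly
PT n with revTable n
... | []    = []
... | p ∷ _ = p

HasDegree : Poly → ℕ → Set
HasDegree p d = (coeff p d ≢ 0) × (∀ j → d < j → coeff p j ≡ 0)

module Submission where

-- We show  deg P^T_n = ⌈n/2⌉  for every n ≥ 1, by strong induction on n,
-- from which both parts of the theorem follow (⌈(2p-1)/2⌉ = ⌈2p/2⌉ = p).
-- The induction rests on three facts about polynomials with coefficients
-- in ℕ: a shift m ↦ m+1 keeps degree and leading coefficient, the degree
-- of a product is the sum of the degrees with the product of the leading
-- coefficients on top, and a sum has the degree of any summand of maximal
-- degree (no cancellation can occur among natural numbers).
-- In  P_{n+2} = P_{n+1}(m+1) + Σ_{i+j=n} P_{i+1} P_{j+1}  every summand has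
-- degree at most ⌈(n+2)/2⌉ because ⌈a/2⌉ + ⌈b/2⌉ ≤ ⌈(a+b+1)/2⌉, and for
-- n ≥ 1 the convolution term P_n · P_1 attains it exactly.

open import Defs
open import Data.Nat using (ℕ; zero; suc; _+_; _*_; _∸_; _≤_; _<_; z≤n; s≤s; ⌈_/2⌉)
open import Data.Nat.Properties
open import Data.Nat.Induction using (<-rec)
open import Data.Product using (_×_; _,_; proj₁; proj₂)
open import Data.Sum using ([_,_]′)
open import Data.List using (List; []; _∷_; map; zipWith; applyUpTo; applyDownFrom)
open import Data.List.Properties using (reverse-applyDownFrom)
open import Data.List.Relation.Unary.All as All using (All; []; _∷_)
open import Function using (_∘_)
open import Relation.Binary.PropositionalEquality

coeff-⊕ : ∀ p q j → coeff (p ⊕ q) j ≡ coeff p j + coeff q j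
coeff-⊕ []      q       j       = refl
coeff-⊕ (a ∷ p) []      j       = sym (+-identityʳ _)
coeff-⊕ (a ∷ p) (b ∷ q) zero    = refl
coeff-⊕ (a ∷ p) (b ∷ q) (suc j) = coeff-⊕ p q j

coeff-scale : ∀ a q j → coeff (map (a *_) q) j ≡ a * coeff q j
coeff-scale a []      j       = sym (*-zeroʳ a)
coeff-scale a (b ∷ q) zero    = refl
coeff-scale a (b ∷ q) (suc j) = coeff-scale a q j

coeff-⊗-cons : ∀ a p q j →
  coeff ((a ∷ p) ⊗ q) j ≡ a * coeff q j + coeff (0 ∷ p ⊗ q) j
coeff-⊗-cons a p q j = begin
  coeff (map (a *_) q ⊕ (0 ∷ p ⊗ q)) j            ≡⟨ coeff-⊕ (map (a *_) q) _ j ⟩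
  coeff (map (a *_) q) j + coeff (0 ∷ p ⊗ q) j    ≡⟨ cong (_+ coeff (0 ∷ p ⊗ q) j) (coeff-scale a q j) ⟩
  a * coeff q j + coeff (0 ∷ p ⊗ q) j             ∎
  where open ≡-Reasoning

IsZero : Poly → Set
IsZero p = ∀ j → coeff p j ≡ 0

DegreeAtMost : Poly → ℕ → Set
DegreeAtMost p d = ∀ j → d < j → coeff p j ≡ 0

isZero-cons : ∀ {r} → IsZero r → IsZero (0 ∷ r)
isZero-cons z zero    = refl
isZero-cons z (suc j) = z j

isZero-⊗ˡ : ∀ p q → IsZero p → IsZero (p ⊗ q)
isZero-⊗ˡ []      q z j = refl
isZero-⊗ˡ (a ∷ p) q z j = begin
  coeff ((a ∷ p) ⊗ q) j              ≡⟨ coeff-⊗-cons a p q j ⟩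
  a * coeff q j + coeff (0 ∷ p ⊗ q) j ≡⟨ cong₂ _+_ (cong (_* coeff q j) (z 0))
                                            (isZero-cons (isZero-⊗ˡ p q (z ∘ suc)) j) ⟩
  0                                   ∎
  where open ≡-Reasoning

isZero-⊗ʳ : ∀ p q → IsZero q → IsZero (p ⊗ q)
isZero-⊗ʳ []      q z j = refl
isZero-⊗ʳ (a ∷ p) q z j = begin
  coeff ((a ∷ p) ⊗ q) j              ≡⟨ coeff-⊗-cons a p q j ⟩
  a * coeff q j + coeff (0 ∷ p ⊗ q) j ≡⟨ cong₂ _+_ (trans (cong (a *_) (z j)) (*-zeroʳ a))
                                            (isZero-cons (isZero-⊗ʳ p q z) j) ⟩
  0                                   ∎
  where open ≡-Reasoning

tail-isZero : ∀ {a p} → DegreeAtMost (a ∷ p) 0 → IsZero p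
tail-isZero D i = D (suc i) (s≤s z≤n)

tail-degree : ∀ {a p d} → DegreeAtMost (a ∷ p) (suc d) → DegreeAtMost p d
tail-degree D j d<j = D (suc j) (s≤s d<j)

constant-degree : ∀ a → DegreeAtMost (a ∷ []) 0
constant-degree a zero    ()
constant-degree a (suc j) _ = refl

linear-degree : ∀ a b → DegreeAtMost (a ∷ b ∷ []) 1
linear-degree a b zero          ()
linear-degree a b (suc zero)    (s≤s ())
linear-degree a b (suc (suc j)) _ = refl

atMost-mono : ∀ p {d e} → d ≤ e → DegreeAtMost p d → DegreeAtMost p e
atMost-mono p d≤e D j e<j = D j (≤-<-trans d≤e e<j)

atMost-⊕ : ∀ p q {d} → DegreeAtMost p d → DegreeAtMost q d → DegreeAtMost (p ⊕ q) d
atMost-⊕ p q Dp Dq j d<j = trans (coeff-⊕ p q j) (cong₂ _+_ (Dp j d<j) (Dq j d<j))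

atMost-polySum : ∀ {d} ps → All (λ p → DegreeAtMost p d) ps → DegreeAtMost (polySum ps) d
atMost-polySum []       []         _ _ = refl
atMost-polySum (p ∷ ps) (Dp ∷ Dps) = atMost-⊕ p (polySum ps) Dp (atMost-polySum ps Dps)

degree-⊗ : ∀ p q a b → DegreeAtMost p a → DegreeAtMost q b →
  DegreeAtMost (p ⊗ q) (a + b) × coeff (p ⊗ q) (a + b) ≡ coeff p a * coeff q b
degree-⊗ []      q a b Dp Dq = (λ _ _ → refl) , refl
degree-⊗ (x ∷ p) q zero b Dp Dq = bound , top
  where
  constant-times : ∀ j → coeff ((x ∷ p) ⊗ q) j ≡ x * coeff q j
  constant-times j = trans (coeff-⊗-cons x p q j)
    (trans (cong (x * coeff q j +_) (isZero-cons (isZero-⊗ˡ p q (tail-isZero Dp)) j))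
           (+-identityʳ _))
  bound : DegreeAtMost ((x ∷ p) ⊗ q) b
  bound j b<j = trans (constant-times j) (trans (cong (x *_) (Dq j b<j)) (*-zeroʳ x))
  top : coeff ((x ∷ p) ⊗ q) b ≡ x * coeff q b
  top = constant-times b
degree-⊗ (x ∷ p) q (suc a) b Dp Dq = bound , top
  where
  ih : DegreeAtMost (p ⊗ q) (a + b) × coeff (p ⊗ q) (a + b) ≡ coeff p a * coeff q b
  ih = degree-⊗ p q a b (tail-degree Dp) Dq
  -- the term x·q only reaches degree b < 1 + a + b
  low-vanishes : ∀ j → a + b ≤ j → x * coeff q (suc j) ≡ 0
  low-vanishes j a+b≤j = trans (cong (x *_) (Dq (suc j) (s≤s (≤-trans (m≤n+m b a) a+b≤j))))
                               (*-zeroʳ x)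
  bound : DegreeAtMost ((x ∷ p) ⊗ q) (suc a + b)
  bound (suc j) (s≤s a+b<j) = trans (coeff-⊗-cons x p q (suc j))
    (cong₂ _+_ (low-vanishes j (<⇒≤ a+b<j)) (proj₁ ih j a+b<j))
  top : coeff ((x ∷ p) ⊗ q) (suc a + b) ≡ coeff p a * coeff q b
  top = trans (coeff-⊗-cons x p q (suc a + b))
    (cong₂ _+_ (low-vanishes (a + b) ≤-refl) (proj₂ ih))

isZero-shift : ∀ p → IsZero p → IsZero (shift p)
isZero-shift []      z j = refl
isZero-shift (a ∷ p) z j = trans (coeff-⊕ (a ∷ []) ((1 ∷ 1 ∷ []) ⊗ shift p) j)
  (cong₂ _+_ (constant-vanishes j) (isZero-⊗ʳ (1 ∷ 1 ∷ []) (shift p) (isZero-shift p (z ∘ suc)) j))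
  where
  constant-vanishes : ∀ j → coeff (a ∷ []) j ≡ 0
  constant-vanishes zero    = z 0
  constant-vanishes (suc j) = refl

degree-shift : ∀ p d → DegreeAtMost p d →
  DegreeAtMost (shift p) d × coeff (shift p) d ≡ coeff p d
degree-shift []      d       D = (λ _ _ → refl) , refl
degree-shift (a ∷ p) zero    D = bound , top
  where
  higher-zero : IsZero ((1 ∷ 1 ∷ []) ⊗ shift p)
  higher-zero = isZero-⊗ʳ (1 ∷ 1 ∷ []) (shift p) (isZero-shift p (tail-isZero D))
  bound : DegreeAtMost (shift (a ∷ p)) 0
  bound = atMost-⊕ (a ∷ []) ((1 ∷ 1 ∷ []) ⊗ shift p) (constant-degree a) (λ j _ → higher-zero j)
  top : coeff (shift (a ∷ p)) 0 ≡ a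
  top = trans (coeff-⊕ (a ∷ []) ((1 ∷ 1 ∷ []) ⊗ shift p) 0)
              (trans (cong (a +_) (higher-zero 0)) (+-identityʳ a))
degree-shift (a ∷ p) (suc d) D = bound , top
  where
  ih : DegreeAtMost (shift p) d × coeff (shift p) d ≡ coeff p d
  ih = degree-shift p d (tail-degree D)
  product : DegreeAtMost ((1 ∷ 1 ∷ []) ⊗ shift p) (1 + d)
          × coeff ((1 ∷ 1 ∷ []) ⊗ shift p) (1 + d) ≡ 1 * coeff (shift p) d
  product = degree-⊗ (1 ∷ 1 ∷ []) (shift p) 1 d (linear-degree 1 1) (proj₁ ih)
  bound : DegreeAtMost (shift (a ∷ p)) (suc d)
  bound = atMost-⊕ (a ∷ []) ((1 ∷ 1 ∷ []) ⊗ shift p)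
            (atMost-mono (a ∷ []) z≤n (constant-degree a)) (proj₁ product)
  top : coeff (shift (a ∷ p)) (suc d) ≡ coeff p d
  top = trans (coeff-⊕ (a ∷ []) ((1 ∷ 1 ∷ []) ⊗ shift p) (suc d))
              (trans (proj₂ product) (trans (*-identityˡ _) (proj₂ ih)))

-- Exact degrees are preserved by shifting and add up under products
-- (ℕ has no zero divisors).
hasDegree-shift : ∀ p {d} → HasDegree p d → HasDegree (shift p) d
hasDegree-shift p {d} (nz , D) =
  (λ e → nz (trans (sym (proj₂ shifted)) e)) , proj₁ shifted
  where
  shifted : DegreeAtMost (shift p) d × coeff (shift p) d ≡ coeff p d
  shifted = degree-shift p d D

hasDegree-⊗ : ∀ p q {a b} → HasDegree p a → HasDegree q b → HasDegree (p ⊗ q) (a + b)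
hasDegree-⊗ p q {a} {b} (nzp , Dp) (nzq , Dq) =
  (λ e → [ nzp , nzq ]′ (m*n≡0⇒m≡0∨n≡0 _ (trans (sym (proj₂ product)) e))) , proj₁ product
  where
  product : DegreeAtMost (p ⊗ q) (a + b) × coeff (p ⊗ q) (a + b) ≡ coeff p a * coeff q b
  product = degree-⊗ p q a b Dp Dq

-- With coefficients in ℕ, adding a polynomial of no larger degree cannot
-- cancel a leading coefficient.
hasDegree-⊕ˡ : ∀ p q {d} → HasDegree p d → DegreeAtMost q d → HasDegree (p ⊕ q) d
hasDegree-⊕ˡ p q {d} (nz , Dp) Dq =
  (λ e → nz (m+n≡0⇒m≡0 _ (trans (sym (coeff-⊕ p q d)) e))) , atMost-⊕ p q Dp Dq

hasDegree-⊕ʳ : ∀ p q {d} → DegreeAtMost p d → HasDegree q d → HasDegree (p ⊕ q) d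
hasDegree-⊕ʳ p q {d} Dp (nz , Dq) =
  (λ e → nz (m+n≡0⇒n≡0 (coeff p d) (trans (sym (coeff-⊕ p q d)) e))) , atMost-⊕ p q Dp Dq

PT-head : ∀ n {x r} → revTable n ≡ x ∷ r → PT n ≡ x
PT-head n eq with revTable n | eq
... | _ | refl = refl

revTable-suc : ∀ n → revTable (suc n) ≡ PT (suc n) ∷ revTable n
revTable-suc zero    = refl
revTable-suc (suc n) = trans unfold (cong₂ _∷_ (sym (PT-head (suc (suc n)) unfold)) (sym (revTable-suc n)))
  where
  unfold : revTable (suc (suc n)) ≡ next (PT (suc n) ∷ revTable n)
  unfold = cong next (revTable-suc n)

PT-recurrence : ∀ n → PT (suc (suc n)) ≡ shift (PT (suc n)) ⊕ conv (revTable n)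
PT-recurrence n = PT-head (suc (suc n)) (cong next (revTable-suc n))

revTable-applyDownFrom : ∀ n → revTable n ≡ applyDownFrom (PT ∘ suc) n
revTable-applyDownFrom zero    = refl
revTable-applyDownFrom (suc n) = trans (revTable-suc n) (cong (PT (suc n) ∷_) (revTable-applyDownFrom n))

conv-revTable : ∀ n →
  conv (revTable n) ≡ polySum (zipWith _⊗_ (applyDownFrom (PT ∘ suc) n) (applyUpTo (PT ∘ suc) n))
conv-revTable n rewrite revTable-applyDownFrom n =
  cong (polySum ∘ zipWith _⊗_ (applyDownFrom (PT ∘ suc) n)) (reverse-applyDownFrom (PT ∘ suc) n)

zipWith-antidiagonal : ∀ {A B C : Set} {P : C → Set} (_∙_ : A → B → C) (f : ℕ → A) (g : ℕ → B) n →
  (∀ i j → i + j ≡ n → P (f i ∙ g j)) →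
  All P (zipWith _∙_ (applyDownFrom f (suc n)) (applyUpTo g (suc n)))
zipWith-antidiagonal _∙_ f g zero    H = H 0 0 refl ∷ []
zipWith-antidiagonal _∙_ f g (suc n) H =
  H (suc n) 0 (+-identityʳ (suc n))
  ∷ zipWith-antidiagonal _∙_ f (g ∘ suc) n (λ i j e → H i (suc j) (trans (+-suc i j) (cong suc e)))

⌈a/2⌉+⌈b/2⌉≤⌈1+a+b/2⌉ : ∀ a b → ⌈ a /2⌉ + ⌈ b /2⌉ ≤ ⌈ suc (a + b) /2⌉
⌈a/2⌉+⌈b/2⌉≤⌈1+a+b/2⌉ zero          b = ⌈n/2⌉-mono (n≤1+n b)
⌈a/2⌉+⌈b/2⌉≤⌈1+a+b/2⌉ (suc zero)    b = ≤-refl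
⌈a/2⌉+⌈b/2⌉≤⌈1+a+b/2⌉ (suc (suc a)) b = s≤s (⌈a/2⌉+⌈b/2⌉≤⌈1+a+b/2⌉ a b)

PT-degree : ∀ n → HasDegree (PT (suc n)) ⌈ suc n /2⌉
PT-degree = <-rec (λ n → HasDegree (PT (suc n)) ⌈ suc n /2⌉) step
  where
  step : ∀ n → (∀ {y} → y < n → HasDegree (PT (suc y)) ⌈ suc y /2⌉) →
         HasDegree (PT (suc n)) ⌈ suc n /2⌉
  step zero _ = (λ ()) , linear-degree 0 1
  step (suc zero) ih =
    subst (λ r → HasDegree r 1) (sym (PT-recurrence 0))
      (hasDegree-⊕ˡ (shift (PT 1)) [] (hasDegree-shift (PT 1) (ih (s≤s z≤n))) (λ _ _ → refl))
  step (suc (suc m)) ih =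
    subst (λ r → HasDegree r D) (sym recurrence)
      (hasDegree-⊕ʳ (shift (T (suc m))) _ shifted
        (hasDegree-⊕ˡ (T m ⊗ T 0) _ leading-term (atMost-polySum _ (All.tail all-terms))))
    where
    D : ℕ
    D = ⌈ suc (suc (suc m)) /2⌉
    T : ℕ → Poly
    T = PT ∘ suc
    terms : List Poly
    terms = zipWith _⊗_ (applyDownFrom T (suc m)) (applyUpTo T (suc m))
    recurrence : PT (suc (suc (suc m))) ≡ shift (T (suc m)) ⊕ polySum terms
    recurrence = trans (PT-recurrence (suc m)) (cong (shift (T (suc m)) ⊕_) (conv-revTable (suc m)))
    shifted : DegreeAtMost (shift (T (suc m))) D
    shifted = atMost-mono (shift (T (suc m))) (⌈n/2⌉-mono (n≤1+n (suc (suc m))))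
      (proj₂ (hasDegree-shift (T (suc m)) (ih ≤-refl)))
    leading-term : HasDegree (T m ⊗ T 0) D
    leading-term = subst (HasDegree (T m ⊗ T 0)) (+-comm ⌈ suc m /2⌉ 1)
      (hasDegree-⊗ (T m) (T 0) (ih (m≤n⇒m≤1+n (n<1+n m))) (ih (s≤s z≤n)))
    term-bound : ∀ i j → i + j ≡ m → DegreeAtMost (T i ⊗ T j) D
    term-bound i j e = atMost-mono (T i ⊗ T j) ⌈⌉-bound
      (proj₁ (degree-⊗ (T i) (T j) _ _ (proj₂ (ih i<)) (proj₂ (ih j<))))
      where
      i< : i < suc (suc m)
      i< = s≤s (m≤n⇒m≤1+n (subst (i ≤_) e (m≤m+n i j)))
      j< : j < suc (suc m)
      j< = s≤s (m≤n⇒m≤1+n (subst (j ≤_) e (m≤n+m j i)))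
      ⌈⌉-bound : ⌈ suc i /2⌉ + ⌈ suc j /2⌉ ≤ D
      ⌈⌉-bound = ≤-trans (⌈a/2⌉+⌈b/2⌉≤⌈1+a+b/2⌉ (suc i) (suc j))
        (≤-reflexive (cong (suc ∘ ⌈_/2⌉) (trans (+-suc i j) (cong suc e))))
    all-terms : All (λ t → DegreeAtMost t D) terms
    all-terms = zipWith-antidiagonal _⊗_ T T m term-bound

-- For p = q + 1:  2p - 1 = 2q + 1  and  2p = (q+1) + (q+1) , both of ⌈_/2⌉ equal to p.
mainTheorem1 : ∀ (p : ℕ) → 1 ≤ p →
    HasDegree (PT (2 * p ∸ 1)) p × HasDegree (PT (2 * p)) p
mainTheorem1 (suc q) _ = odd , even
  where
  2p≡p+p : 2 * suc q ≡ suc q + suc q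
  2p≡p+p = cong (suc q +_) (+-identityʳ (suc q))
  odd : HasDegree (PT (2 * suc q ∸ 1)) (suc q)
  odd = subst₂ (λ n d → HasDegree (PT n) d)
          (sym (trans (cong (_∸ 1) 2p≡p+p) (+-suc q q))) (cong suc (sym (n≡⌊n+n/2⌋ q)))
          (PT-degree (q + q))
  even : HasDegree (PT (2 * suc q)) (suc q)
  even = subst₂ (λ n d → HasDegree (PT n) d)
           (sym 2p≡p+p) (sym (n≡⌈n+n/2⌉ (suc q)))
           (PT-degree (q + suc q))
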